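{- Let $\mathfrak g$ be the rank 2 hyperbolic Kac–Moody algebra with generalized Cartan matrix $\mathsf A=\begin{pmatrix}2&-b\\-a&2\end{pmatrix}$, where $a,b\ge2$ and $ab\ge5$. Then every maximal parabolic subgroup of the associated real Kac–Moody group $G_\mathbb R$ satisfies Property RD.
   Context: $I=\{1,2\}$; simple roots $\alpha_1,\alpha_2$, coroots $\alpha_i^\vee$ with $\langle\alpha_j,\alpha_i^\vee\rangle=a_{ij}$, fundamental weights $\varpi_i$, Weyl group $W$ (infinite dihedral, generated by $w_1,w_2$), roots $\Phi=\Phi_+\sqcup\Phi_-$, $\alpha^\vee$ the coroot of a real root $\alpha$, $\Phi_w=\Phi_+\cap w^{ -1}\Phi_-$. $G_\mathbb R$ is the real representation-theoretic Kac–Moody group with Borel subgroup $B$; the maximal parabolic subgroups are $P_\theta=BW_\theta B$ with $\theta=\{1\}$ or $\{2\}$, $i_P$ the other index, $\alpha_P=\alpha_{i_P}$, $\varpi_P=\varpi_{i_P}$. $\rho_M=\frac12\alpha_i$ for $\theta=\{i\}$. $W^\theta=\{w\in W:w^{ -1}\alpha_i>0,\ i\in\theta\}$. Property RD for $P_\theta$: there exists $D>0$ such that $\langle D\varpi_P+\rho_M,\alpha^\vee\rangle\le0$ for every nontrivial $w\in W^\theta$ and every $\alpha\in\Phi_{w^{ -1}}$. -}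

module Defs where

open import Data.Nat using (ℕ; zero; suc)
open import Data.Integer as ℤ using (ℤ; +_; -_)
open import Data.Rational as ℚ using (ℚ)
open import Data.Empty using (⊥)
open import Data.Unit using (⊤)
open import Data.Product using (_×_; ∃)
open import Relation.Binary.PropositionalEquality using (_≢_)

data I : Set where
  i₁ i₂ : I

other : I → I
other i₁ = i₂
other i₂ = i₁

-- Generalized Cartan matrix A = ((2, -b), (-a, 2)),  A i j = a_ij = ⟨α_j , α_i^∨⟩
cartan : ℕ → ℕ → I → I → ℤ
cartan a b i₁ i₁ = + 2
cartan a b i₁ i₂ = - (+ b)
cartan a b i₂ i₁ = - (+ a)
cartan a b i₂ i₂ = + 2

-- Elements of the root lattice ⊕ ℤα_j (β j = coefficient of α_j) and of the
-- coroot lattice ⊕ ℤα_i^∨ (γ i = coefficient of α_i^∨).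
RootL : Set
RootL = I → ℤ

CorootL : Set
CorootL = I → ℤ

basis : I → I → ℤ
basis i₁ i₁ = + 1
basis i₁ i₂ = + 0
basis i₂ i₁ = + 0
basis i₂ i₂ = + 1

pair : ℕ → ℕ → RootL → CorootL → ℤ
pair a b β γ =
  β i₁ ℤ.* γ i₁ ℤ.* cartan a b i₁ i₁ ℤ.+ β i₂ ℤ.* γ i₁ ℤ.* cartan a b i₁ i₂
  ℤ.+ (β i₁ ℤ.* γ i₂ ℤ.* cartan a b i₂ i₁ ℤ.+ β i₂ ℤ.* γ i₂ ℤ.* cartan a b i₂ i₂)

reflR : ℕ → ℕ → I → RootL → RootL
reflR a b i β j = β j ℤ.- pair a b β (basis i) ℤ.* basis i j

reflC : ℕ → ℕ → I → CorootL → CorootL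
reflC a b i γ k = γ k ℤ.- pair a b (basis i) γ ℤ.* basis i k

-- The Weyl group W (infinite dihedral), each element given by its unique
-- reduced word:  one = identity,  alt i n = w_i w_{i'} w_i ⋯  (n+1 alternating letters).
data W : Set where
  one : W
  alt : I → ℕ → W

lastLetter : I → ℕ → I
lastLetter i zero = i
lastLetter i (suc n) = lastLetter (other i) n

inv : W → W
inv one = one
inv (alt i n) = alt (lastLetter i n) n

altR : ℕ → ℕ → I → ℕ → RootL → RootL
altR a b i zero β = reflR a b i β
altR a b i (suc n) β = reflR a b i (altR a b (other i) n β)

actR : ℕ → ℕ → W → RootL → RootL
actR a b one β = β
actR a b (alt i n) β = altR a b i n β

altC : ℕ → ℕ → I → ℕ → CorootL → CorootL
altC a b i zero γ = reflC a b i γ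
altC a b i (suc n) γ = reflC a b i (altC a b (other i) n γ)

actC : ℕ → ℕ → W → CorootL → CorootL
actC a b one γ = γ
actC a b (alt i n) γ = altC a b i n γ

Positive : RootL → Set
Positive β = (∀ j → + 0 ℤ.≤ β j) × ∃ (λ j → β j ≢ + 0)

Negative : RootL → Set
Negative β = Positive (λ j → - β j)

-- Real roots are α = u α_j (u ∈ W, j ∈ I), with coroot α^∨ = u α_j^∨.
realRoot : ℕ → ℕ → W → I → RootL
realRoot a b u j = actR a b u (basis j)

realCoroot : ℕ → ℕ → W → I → CorootL
realCoroot a b u j = actC a b u (basis j)

InWθ : ℕ → ℕ → I → W → Set
InWθ a b i w = Positive (actR a b (inv w) (basis i))

Nontrivial : W → Set
Nontrivial one = ⊥
Nontrivial (alt _ _) = ⊤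

InΦ : ℕ → ℕ → W → RootL → Set
InΦ a b v α = Positive α × Negative (actR a b v α)

-- ⟨D ϖ_P + ρ_M , γ⟩ for θ = {i}, i_P = other i, ρ_M = ½ α_i
weightPair : ℕ → ℕ → I → ℚ → CorootL → ℚ
weightPair a b i D γ =
  D ℚ.* (γ (other i) ℚ./ 1) ℚ.+ ℚ.½ ℚ.* (pair a b (basis i) γ ℚ./ 1)

PropertyRD : ℕ → ℕ → I → Set
PropertyRD a b i =
  ∃ λ (D : ℚ) → ℚ.0ℚ ℚ.< D ×
    (∀ (w : W) → Nontrivial w → InWθ a b i w →
     ∀ (u : W) (j : I) → InΦ a b (inv w) (realRoot a b u j) →
     weightPair a b i D (realCoroot a b u j) ℚ.≤ ℚ.0ℚ)

-- For ab ≥ 5 put C_k = {β | β_k > 0, β_{k′} ≥ 0, ⟨β , α_k^∨⟩ ≥ 0} (k′ the other index).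
-- Then w_k C_{k′} ⊆ C_k, so every real root u α_j lies in ± C_k, where k is the first letter
-- of u (k = j if u = 1), and its coroot lies in the same cone for the transposed matrix.
-- For a nontrivial w ∈ W^{i} the first letter of w is i_P; a positive root α with w⁻¹ α < 0
-- cannot lie in C_i, since w⁻¹ maps C_i into a cone, so α ∈ C_{i_P}.  Writing
-- α^∨ = n α_i^∨ + m α_{i_P}^∨ and c, d ≥ 2 for the off-diagonal Cartan entries (cd = ab ≥ 5),
-- the cone condition c n ≤ 2 m gives 6 n + 2 m ≤ 3 d m, that is
-- ⟨⅓ ϖ_P + ½ α_i , α^∨⟩ = m/3 + n − d m/2 ≤ 0.  So D = ⅓ works for both parabolics.

module Submission where

open import Defs
open import Data.Nat using (ℕ; zero; suc; _+_; _*_; _∸_; _≤_; _<_; s≤s; z≤n; >-nonZero)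
open import Data.Nat.Properties
  using ( ≤-trans; ≤-<-trans; <⇒≤; n≤1+n; n<1+n; m≤m+n; m∸n+n≡m; m<n⇒0<n∸m
        ; +-identityʳ; +-monoˡ-≤; +-monoʳ-≤; +-cancelʳ-<
        ; *-comm; *-assoc; *-zeroʳ; *-monoˡ-≤; *-monoʳ-≤; *-monoˡ-<; *-cancelˡ-≤; *-cancelˡ-<
        ; module ≤-Reasoning)
open import Data.Nat.Tactic.RingSolver using (solve)
open import Data.Integer as ℤ using (+_; -_; 0ℤ)
import Data.Integer.Properties as ℤP
open import Data.Integer.Tactic.RingSolver using (solve-∀)
open import Data.Rational as ℚ using (ℚ)
import Data.Rational.Properties as ℚP
import Data.Rational.Unnormalised as ℚᵘ
import Data.Rational.Unnormalised.Properties as ℚᵘP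
open import Data.List using ([]; _∷_)
open import Data.Product using (Σ; _×_; _,_)
open import Data.Empty using (⊥-elim)
open import Relation.Nullary using (¬_; yes; no; contradiction)
open import Relation.Binary.Definitions using (DecidableEquality)
open import Relation.Binary.PropositionalEquality

other-involutive : ∀ k → other (other k) ≡ k
other-involutive i₁ = refl
other-involutive i₂ = refl

_≟_ : DecidableEquality I
i₁ ≟ i₁ = yes refl
i₁ ≟ i₂ = no λ ()
i₂ ≟ i₁ = no λ ()
i₂ ≟ i₂ = yes refl

≢⇒≡other : ∀ {j k} → j ≢ k → j ≡ other k
≢⇒≡other {i₁} {i₁} j≢k = contradiction refl j≢k
≢⇒≡other {i₁} {i₂} _ = refl
≢⇒≡other {i₂} {i₁} _ = refl
≢⇒≡other {i₂} {i₂} j≢k = contradiction refl j≢k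

lastLetter-other : ∀ k n → lastLetter (other k) n ≡ other (lastLetter k n)
lastLetter-other k zero = refl
lastLetter-other k (suc n) = lastLetter-other (other k) n

lastLetter-involutive : ∀ k n → lastLetter (lastLetter k n) n ≡ k
lastLetter-involutive k zero = refl
lastLetter-involutive k (suc n) = begin
  lastLetter (other (lastLetter (other k) n)) n  ≡⟨ lastLetter-other (lastLetter (other k) n) n ⟩
  other (lastLetter (lastLetter (other k) n) n)  ≡⟨ cong other (lastLetter-involutive (other k) n) ⟩
  other (other k)                                ≡⟨ other-involutive k ⟩
  k                                              ∎
  where open ≡-Reasoning

reflection-bound : ∀ {c d m n} → 5 ≤ c * d → 0 < m → c * n ≤ 2 * m → 2 * n < d * m
reflection-bound {c} {d} {m} {n} 5≤cd m>0 cn≤2m = *-cancelˡ-< c (2 * n) (d * m) (begin-strict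
  c * (2 * n)  ≡⟨ solve (c ∷ n ∷ []) ⟩
  2 * (c * n)  ≤⟨ *-monoʳ-≤ 2 cn≤2m ⟩
  2 * (2 * m)  ≡⟨ solve (m ∷ []) ⟩
  4 * m        <⟨ *-monoˡ-< m {{>-nonZero m>0}} (n<1+n 4) ⟩
  5 * m        ≤⟨ *-monoˡ-≤ m 5≤cd ⟩
  c * d * m    ≡⟨ *-assoc c d m ⟩
  c * (d * m)  ∎)
  where open ≤-Reasoning

≤-double-∸ : ∀ {n s} → 2 * n < s → s ≤ 2 * (s ∸ n)
≤-double-∸ {n} {s} 2n<s = begin
  s        ≡⟨ sym s≡z+n ⟩
  z + n    ≤⟨ +-monoʳ-≤ z (<⇒≤ n<z) ⟩
  z + z    ≡⟨ cong (_+_ z) (sym (+-identityʳ z)) ⟩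
  2 * z    ∎
  where
  open ≤-Reasoning
  z = s ∸ n
  s≡z+n : z + n ≡ s
  s≡z+n = m∸n+n≡m (≤-trans (m≤m+n n (n + 0)) (<⇒≤ 2n<s))
  n<z : n < z
  n<z = +-cancelʳ-< n n z (begin-strict
    n + n  ≡⟨ solve (n ∷ []) ⟩
    2 * n  <⟨ 2n<s ⟩
    s      ≡⟨ sym s≡z+n ⟩
    z + n  ∎)

rd-bound : ∀ {c d m n} → 2 ≤ c → 2 ≤ d → 5 ≤ c * d → c * n ≤ 2 * m → 6 * n + 2 * m ≤ 3 * d * m
rd-bound {zero} () _ _ _
rd-bound {suc zero} (s≤s ()) _ _ _
rd-bound {d = zero} _ () _ _
rd-bound {d = suc zero} _ (s≤s ()) _ _
rd-bound {suc (suc zero)} {suc (suc zero)} _ _ (s≤s (s≤s (s≤s (s≤s ())))) _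
rd-bound {suc (suc zero)} {d@(suc (suc (suc _)))} {m} {n} _ _ _ 2n≤2m = begin
  6 * n + 2 * m  ≤⟨ +-monoˡ-≤ (2 * m) (*-monoʳ-≤ 6 n≤m) ⟩
  6 * m + 2 * m  ≡⟨ solve (m ∷ []) ⟩
  8 * m          ≤⟨ *-monoˡ-≤ m 8≤3d ⟩
  3 * d * m      ∎
  where
  open ≤-Reasoning
  n≤m : n ≤ m
  n≤m = *-cancelˡ-≤ 2 2n≤2m
  8≤3d : 8 ≤ 3 * d
  8≤3d = ≤-trans (n≤1+n 8) (*-monoʳ-≤ 3 (s≤s (s≤s (s≤s z≤n))))
rd-bound {c@(suc (suc (suc _)))} {d} {m} {n} _ 2≤d _ cn≤2m = begin
  6 * n + 2 * m        ≡⟨ solve (n ∷ m ∷ []) ⟩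
  2 * (3 * n) + 2 * m  ≤⟨ +-monoˡ-≤ (2 * m) (*-monoʳ-≤ 2 3n≤2m) ⟩
  2 * (2 * m) + 2 * m  ≡⟨ solve (m ∷ []) ⟩
  6 * m                ≤⟨ *-monoˡ-≤ m (*-monoʳ-≤ 3 2≤d) ⟩
  3 * d * m            ∎
  where
  open ≤-Reasoning
  3≤c : 3 ≤ c
  3≤c = s≤s (s≤s (s≤s z≤n))
  3n≤2m : 3 * n ≤ 2 * m
  3n≤2m = ≤-trans (*-monoˡ-≤ n 3≤c) cn≤2m

offDiagonal : ℕ → ℕ → I → ℕ
offDiagonal a b i₁ = b
offDiagonal a b i₂ = a

offDiagonal-≥2 : ∀ {a b} → 2 ≤ a → 2 ≤ b → ∀ k → 2 ≤ offDiagonal a b k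
offDiagonal-≥2 _ 2≤b i₁ = 2≤b
offDiagonal-≥2 2≤a _ i₂ = 2≤a

offDiagonal-product : ∀ {a b} → 5 ≤ a * b → ∀ k → 5 ≤ offDiagonal a b (other k) * offDiagonal a b k
offDiagonal-product 5≤ab i₁ = 5≤ab
offDiagonal-product {a} {b} 5≤ab i₂ = subst (5 ≤_) (*-comm a b) 5≤ab

basis-diagonal : ∀ k → basis k k ≡ + 1
basis-diagonal i₁ = refl
basis-diagonal i₂ = refl

basis-other : ∀ k → basis k (other k) ≡ + 0
basis-other i₁ = refl
basis-other i₂ = refl

neg : RootL → RootL
neg β j = - β j

-- Swapping a and b transposes A; so the action of W on coroots is its action on roots for Aᵀ.
pair-transpose : ∀ a b β γ → pair a b β γ ≡ pair b a γ β
pair-transpose a b β γ = bilinear-transpose (β i₁) (β i₂) (γ i₁) (γ i₂) (+ a) (+ b)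
  where
  bilinear-transpose : ∀ x₁ x₂ y₁ y₂ A B →
    x₁ ℤ.* y₁ ℤ.* + 2 ℤ.+ x₂ ℤ.* y₁ ℤ.* - B ℤ.+ (x₁ ℤ.* y₂ ℤ.* - A ℤ.+ x₂ ℤ.* y₂ ℤ.* + 2) ≡
    y₁ ℤ.* x₁ ℤ.* + 2 ℤ.+ y₂ ℤ.* x₁ ℤ.* - A ℤ.+ (y₁ ℤ.* x₂ ℤ.* - B ℤ.+ y₂ ℤ.* x₂ ℤ.* + 2)
  bilinear-transpose = solve-∀

pair-neg : ∀ a b β γ → pair a b (neg β) γ ≡ - pair a b β γ
pair-neg a b β γ = bilinear-neg (β i₁) (β i₂) (γ i₁) (γ i₂)
  (cartan a b i₁ i₁) (cartan a b i₁ i₂) (cartan a b i₂ i₁) (cartan a b i₂ i₂)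
  where
  bilinear-neg : ∀ x₁ x₂ y₁ y₂ c₁₁ c₁₂ c₂₁ c₂₂ →
    - x₁ ℤ.* y₁ ℤ.* c₁₁ ℤ.+ - x₂ ℤ.* y₁ ℤ.* c₁₂ ℤ.+ (- x₁ ℤ.* y₂ ℤ.* c₂₁ ℤ.+ - x₂ ℤ.* y₂ ℤ.* c₂₂) ≡
    - (x₁ ℤ.* y₁ ℤ.* c₁₁ ℤ.+ x₂ ℤ.* y₁ ℤ.* c₁₂ ℤ.+ (x₁ ℤ.* y₂ ℤ.* c₂₁ ℤ.+ x₂ ℤ.* y₂ ℤ.* c₂₂))
  bilinear-neg = solve-∀

pair-congˡ : ∀ a b {β β′} γ → β ≗ β′ → pair a b β γ ≡ pair a b β′ γ
pair-congˡ a b γ β≗β′ = cong₂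
  (λ x₁ x₂ → x₁ ℤ.* γ i₁ ℤ.* cartan a b i₁ i₁ ℤ.+ x₂ ℤ.* γ i₁ ℤ.* cartan a b i₁ i₂
             ℤ.+ (x₁ ℤ.* γ i₂ ℤ.* cartan a b i₂ i₁ ℤ.+ x₂ ℤ.* γ i₂ ℤ.* cartan a b i₂ i₂))
  (β≗β′ i₁) (β≗β′ i₂)

pair-simpleCoroot : ∀ a b k β →
  pair a b β (basis k) ≡ + 2 ℤ.* β k ℤ.- + offDiagonal a b k ℤ.* β (other k)
pair-simpleCoroot a b i₁ β = row₁ (β i₁) (β i₂) (+ a) (+ b)
  where
  row₁ : ∀ x₁ x₂ A B →
    x₁ ℤ.* + 1 ℤ.* + 2 ℤ.+ x₂ ℤ.* + 1 ℤ.* - B ℤ.+ (x₁ ℤ.* + 0 ℤ.* - A ℤ.+ x₂ ℤ.* + 0 ℤ.* + 2) ≡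
    + 2 ℤ.* x₁ ℤ.- B ℤ.* x₂
  row₁ = solve-∀
pair-simpleCoroot a b i₂ β = row₂ (β i₁) (β i₂) (+ a) (+ b)
  where
  row₂ : ∀ x₁ x₂ A B →
    x₁ ℤ.* + 0 ℤ.* + 2 ℤ.+ x₂ ℤ.* + 0 ℤ.* - B ℤ.+ (x₁ ℤ.* + 1 ℤ.* - A ℤ.+ x₂ ℤ.* + 1 ℤ.* + 2) ≡
    + 2 ℤ.* x₂ ℤ.- A ℤ.* x₁
  row₂ = solve-∀

reflR-self : ∀ a b k β → reflR a b k β k ≡ + offDiagonal a b k ℤ.* β (other k) ℤ.- β k
reflR-self a b k β = begin
  β k ℤ.- pair a b β (basis k) ℤ.* basis k k
    ≡⟨ cong₂ (λ p e → β k ℤ.- p ℤ.* e) (pair-simpleCoroot a b k β) (basis-diagonal k) ⟩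
  β k ℤ.- (+ 2 ℤ.* β k ℤ.- c ℤ.* β (other k)) ℤ.* + 1
    ≡⟨ reflect (β k) (β (other k)) c ⟩
  c ℤ.* β (other k) ℤ.- β k
    ∎
  where
  open ≡-Reasoning
  c = + offDiagonal a b k
  reflect : ∀ x y c → x ℤ.- (+ 2 ℤ.* x ℤ.- c ℤ.* y) ℤ.* + 1 ≡ c ℤ.* y ℤ.- x
  reflect = solve-∀

reflR-other : ∀ a b k β → reflR a b k β (other k) ≡ β (other k)
reflR-other a b k β = trans
  (cong (λ e → β (other k) ℤ.- pair a b β (basis k) ℤ.* e) (basis-other k))
  (drop-zero (β (other k)) (pair a b β (basis k)))
  where
  drop-zero : ∀ y p → y ℤ.- p ℤ.* + 0 ≡ y
  drop-zero = solve-∀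

reflR-neg : ∀ a b k β → reflR a b k (neg β) ≗ neg (reflR a b k β)
reflR-neg a b k β j = begin
  - β j ℤ.- pair a b (neg β) (basis k) ℤ.* basis k j
    ≡⟨ cong (λ p → - β j ℤ.- p ℤ.* basis k j) (pair-neg a b β (basis k)) ⟩
  - β j ℤ.- - pair a b β (basis k) ℤ.* basis k j
    ≡⟨ linear (β j) (pair a b β (basis k)) (basis k j) ⟩
  - (β j ℤ.- pair a b β (basis k) ℤ.* basis k j)
    ∎
  where
  open ≡-Reasoning
  linear : ∀ x p e → - x ℤ.- - p ℤ.* e ≡ - (x ℤ.- p ℤ.* e)
  linear = solve-∀

reflR-cong : ∀ a b k {β β′} → β ≗ β′ → reflR a b k β ≗ reflR a b k β′
reflR-cong a b k β≗β′ j =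
  cong₂ (λ x p → x ℤ.- p ℤ.* basis k j) (β≗β′ j) (pair-congˡ a b (basis k) β≗β′)

reflR-simpleRoot : ∀ a b k → reflR a b k (basis k) ≗ neg (basis k)
reflR-simpleRoot a b i₁ i₁ = refl
reflR-simpleRoot a b i₁ i₂ = refl
reflR-simpleRoot a b i₂ i₁ = refl
reflR-simpleRoot a b i₂ i₂ = refl

reflC-transpose : ∀ a b k γ → reflC a b k γ ≗ reflR b a k γ
reflC-transpose a b k γ j = cong (λ p → γ j ℤ.- p ℤ.* basis k j) (pair-transpose a b (basis k) γ)

altC-transpose : ∀ a b k n γ → altC a b k n γ ≗ altR b a k n γ
altC-transpose a b k zero γ = reflC-transpose a b k γ
altC-transpose a b k (suc n) γ j =
  trans (reflC-transpose a b k (altC a b (other k) n γ) j)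
        (reflR-cong b a k (altC-transpose a b (other k) n γ) j)

realCoroot-transpose : ∀ a b u j → realCoroot a b u j ≗ realRoot b a u j
realCoroot-transpose a b one j _ = refl
realCoroot-transpose a b (alt k n) j = altC-transpose a b k n (basis j)

-- β ∈ C_k in coordinates β_k = lead, β_{other k} = rest; bounded is ⟨β , α_k^∨⟩ ≥ 0.
record Cone (a b : ℕ) (k : I) (β : RootL) : Set where
  constructor cone
  field
    lead rest : ℕ
    lead≡ : β k ≡ + lead
    rest≡ : β (other k) ≡ + rest
    lead>0 : 0 < lead
    bounded : offDiagonal a b k * rest ≤ 2 * lead

cone-cong : ∀ {a b k β β′} → β ≗ β′ → Cone a b k β → Cone a b k β′
cone-cong {k = k} β≗β′ (cone m n m≡ n≡ m>0 bound) =
  cone m n (trans (sym (β≗β′ k)) m≡) (trans (sym (β≗β′ (other k))) n≡) m>0 bound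

basis-cone : ∀ a b k → Cone a b k (basis k)
basis-cone a b k = cone 1 0 (basis-diagonal k) (basis-other k) (s≤s z≤n)
  (subst (_≤ 2) (sym (*-zeroʳ (offDiagonal a b k))) z≤n)

¬0≤-pos : ∀ {x m} → x ≡ + m → 0 < m → ¬ (+ 0 ℤ.≤ - x)
¬0≤-pos refl (s≤s z≤n) ()

cone⇒¬negative : ∀ {a b k β} → Cone a b k β → ¬ Negative β
cone⇒¬negative {k = k} (cone _ _ m≡ _ m>0 _) (0≤-β , _) = ¬0≤-pos m≡ m>0 (0≤-β k)

negCone⇒¬positive : ∀ {a b k β} → Cone a b k (neg β) → ¬ Positive β
negCone⇒¬positive {k = k} {β} (cone _ _ m≡ _ m>0 _) (0≤β , _) =
  ¬0≤-pos m≡ m>0 (subst (+ 0 ℤ.≤_) (sym (ℤP.neg-involutive (β k))) (0≤β k))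

module RootCones (a b : ℕ) (5≤ab : 5 ≤ a * b) where

  reflR-cone : ∀ k {β} → Cone a b (other k) β → Cone a b k (reflR a b k β)
  reflR-cone k {β} (cone m n m≡ n≡ m>0 bound) =
    cone (d * m ∸ n) m reflected≡ (trans (reflR-other a b k β) m≡) (m<n⇒0<n∸m n<dm) (≤-double-∸ {n} 2n<dm)
    where
    d = offDiagonal a b k
    2n<dm : 2 * n < d * m
    2n<dm = reflection-bound {offDiagonal a b (other k)} {d} (offDiagonal-product 5≤ab k) m>0 bound
    n<dm : n < d * m
    n<dm = ≤-<-trans (m≤m+n n (n + 0)) 2n<dm
    βk≡ : β k ≡ + n
    βk≡ = trans (cong β (sym (other-involutive k))) n≡
    reflected≡ : reflR a b k β k ≡ + (d * m ∸ n)
    reflected≡ = begin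
      reflR a b k β k                   ≡⟨ reflR-self a b k β ⟩
      + d ℤ.* β (other k) ℤ.- β k       ≡⟨ cong₂ (λ x y → + d ℤ.* x ℤ.- y) m≡ βk≡ ⟩
      + d ℤ.* + m ℤ.- + n               ≡⟨ cong (ℤ._- + n) (sym (ℤP.pos-* d m)) ⟩
      + (d * m) ℤ.- + n                 ≡⟨ ℤP.m-n≡m⊖n (d * m) n ⟩
      (d * m) ℤ.⊖ n                     ≡⟨ ℤP.⊖-≥ (<⇒≤ n<dm) ⟩
      + (d * m ∸ n)                     ∎
      where open ≡-Reasoning

  reflR-negCone : ∀ k {β} → Cone a b (other k) (neg β) → Cone a b k (neg (reflR a b k β))
  reflR-negCone k {β} c = cone-cong (reflR-neg a b k β) (reflR-cone k c)

  altR-cone : ∀ k n {β} → Cone a b (other (lastLetter k n)) β → Cone a b k (altR a b k n β)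
  altR-cone k zero c = reflR-cone k c
  altR-cone k (suc n) c = reflR-cone k (altR-cone (other k) n c)

  realRoot-cone : ∀ k n {j} → j ≢ lastLetter k n → Cone a b k (realRoot a b (alt k n) j)
  realRoot-cone k n {j} j≢ =
    altR-cone k n (subst (λ l → Cone a b l (basis j)) (≢⇒≡other j≢) (basis-cone a b j))

  realRoot-negCone : ∀ k n {j} → j ≡ lastLetter k n → Cone a b k (neg (realRoot a b (alt k n) j))
  realRoot-negCone k zero refl = cone-cong basis≗-w[basis] (basis-cone a b k)
    where
    basis≗-w[basis] : basis k ≗ neg (reflR a b k (basis k))
    basis≗-w[basis] j =
      trans (sym (ℤP.neg-involutive (basis k j))) (cong -_ (sym (reflR-simpleRoot a b k j)))
  realRoot-negCone k (suc n) j≡ = reflR-negCone k (realRoot-negCone (other k) n j≡)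

  alt∉Wθ : ∀ i n → ¬ InWθ a b i (alt i n)
  alt∉Wθ i n = negCone⇒¬positive (realRoot-negCone (lastLetter i n) n (sym (lastLetter-involutive i n)))

  inv-alt-cone : ∀ k n {β} → Cone a b (other k) β →
                 Cone a b (lastLetter k n) (actR a b (inv (alt k n)) β)
  inv-alt-cone k n {β} c = altR-cone (lastLetter k n) n
    (subst (λ l → Cone a b (other l) β) (sym (lastLetter-involutive k n)) c)

positiveRealRoot-cones : ∀ {a b} → 5 ≤ a * b → ∀ u j → Positive (realRoot a b u j) →
  Σ I λ k → Cone a b k (realRoot a b u j) × Cone b a k (realCoroot a b u j)
positiveRealRoot-cones {a} {b} _ one j _ = j , basis-cone a b j , basis-cone b a j
positiveRealRoot-cones {a} {b} 5≤ab (alt k n) j α>0 with j ≟ lastLetter k n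
... | yes j≡ = ⊥-elim (negCone⇒¬positive (RootCones.realRoot-negCone a b 5≤ab k n j≡) α>0)
... | no j≢ = k , RootCones.realRoot-cone a b 5≤ab k n j≢
  , cone-cong (λ l → sym (realCoroot-transpose a b (alt k n) j l))
              (RootCones.realRoot-cone b a (subst (5 ≤_) (*-comm a b) 5≤ab) k n j≢)

⅓ : ℚ
⅓ = + 1 ℚ./ 3

third-plus-half-nonPos : ∀ x y → + 2 ℤ.* x ℤ.+ + 3 ℤ.* y ℤ.≤ 0ℤ →
  ⅓ ℚ.* (x ℚ./ 1) ℚ.+ ℚ.½ ℚ.* (y ℚ./ 1) ℚ.≤ ℚ.0ℚ
third-plus-half-nonPos x y 2x+3y≤0 = ℚP.toℚᵘ-cancel-≤ (begin
  ℚ.toℚᵘ (⅓ ℚ.* (x ℚ./ 1) ℚ.+ ℚ.½ ℚ.* (y ℚ./ 1))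
    ≃⟨ ℚP.toℚᵘ-homo-+ (⅓ ℚ.* (x ℚ./ 1)) (ℚ.½ ℚ.* (y ℚ./ 1)) ⟩
  ℚ.toℚᵘ (⅓ ℚ.* (x ℚ./ 1)) ℚᵘ.+ ℚ.toℚᵘ (ℚ.½ ℚ.* (y ℚ./ 1))
    ≃⟨ ℚᵘP.+-cong (ℚP.toℚᵘ-homo-* ⅓ (x ℚ./ 1)) (ℚP.toℚᵘ-homo-* ℚ.½ (y ℚ./ 1)) ⟩
  ℚ.toℚᵘ ⅓ ℚᵘ.* ℚ.toℚᵘ (x ℚ./ 1) ℚᵘ.+ ℚ.toℚᵘ ℚ.½ ℚᵘ.* ℚ.toℚᵘ (y ℚ./ 1)
    ≃⟨ ℚᵘP.+-cong (ℚᵘP.*-cong (ℚP.toℚᵘ-fromℚᵘ (ℚᵘ.mkℚᵘ (+ 1) 2)) (ℚP.toℚᵘ-fromℚᵘ (ℚᵘ.mkℚᵘ x 0)))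
                  (ℚᵘP.*-cong (ℚP.toℚᵘ-fromℚᵘ (ℚᵘ.mkℚᵘ (+ 1) 1)) (ℚP.toℚᵘ-fromℚᵘ (ℚᵘ.mkℚᵘ y 0))) ⟩
  ℚᵘ.mkℚᵘ (+ 1) 2 ℚᵘ.* ℚᵘ.mkℚᵘ x 0 ℚᵘ.+ ℚᵘ.mkℚᵘ (+ 1) 1 ℚᵘ.* ℚᵘ.mkℚᵘ y 0
    ≤⟨ ℚᵘ.*≤* (subst (ℤ._≤ 0ℤ) (cross-multiplied x y) 2x+3y≤0) ⟩
  ℚ.toℚᵘ ℚ.0ℚ
    ∎)
  where
  -- ℚᵘ.mkℚᵘ p k denotes p / (k + 1).
  open ℚᵘP.≤-Reasoning
  cross-multiplied : ∀ x y →
    + 2 ℤ.* x ℤ.+ + 3 ℤ.* y ≡ ((+ 1 ℤ.* x) ℤ.* + 2 ℤ.+ (+ 1 ℤ.* y) ℤ.* + 3) ℤ.* + 1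
  cross-multiplied = solve-∀

numerator-nonPos : ∀ {d m n} → 6 * n + 2 * m ≤ 3 * d * m →
  + 2 ℤ.* + m ℤ.+ + 3 ℤ.* (+ 2 ℤ.* + n ℤ.- + d ℤ.* + m) ℤ.≤ 0ℤ
numerator-nonPos {d} {m} {n} h = subst (ℤ._≤ 0ℤ) numerator≡ (ℤP.i≤j⇒i-j≤0 (ℤ.+≤+ h))
  where
  open ≡-Reasoning
  expand : ∀ d m n →
    + 6 ℤ.* n ℤ.+ + 2 ℤ.* m ℤ.- + 3 ℤ.* d ℤ.* m ≡ + 2 ℤ.* m ℤ.+ + 3 ℤ.* (+ 2 ℤ.* n ℤ.- d ℤ.* m)
  expand = solve-∀
  numerator≡ : + (6 * n + 2 * m) ℤ.- + (3 * d * m) ≡ + 2 ℤ.* + m ℤ.+ + 3 ℤ.* (+ 2 ℤ.* + n ℤ.- + d ℤ.* + m)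
  numerator≡ = begin
    + (6 * n + 2 * m) ℤ.- + (3 * d * m)
      ≡⟨ cong₂ ℤ._-_ (trans (ℤP.pos-+ (6 * n) (2 * m)) (cong₂ ℤ._+_ (ℤP.pos-* 6 n) (ℤP.pos-* 2 m)))
                     (trans (ℤP.pos-* (3 * d) m) (cong (ℤ._* + m) (ℤP.pos-* 3 d))) ⟩
    + 6 ℤ.* + n ℤ.+ + 2 ℤ.* + m ℤ.- + 3 ℤ.* + d ℤ.* + m
      ≡⟨ expand (+ d) (+ m) (+ n) ⟩
    + 2 ℤ.* + m ℤ.+ + 3 ℤ.* (+ 2 ℤ.* + n ℤ.- + d ℤ.* + m)
      ∎

weightPair-nonPos : ∀ {a b} → 2 ≤ a → 2 ≤ b → 5 ≤ b * a →
  ∀ i {γ} → Cone b a (other i) γ → weightPair a b i ⅓ γ ℚ.≤ ℚ.0ℚ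
weightPair-nonPos {a} {b} 2≤a 2≤b 5≤ba i {γ} (cone m n m≡ n≡ _ bound) =
  third-plus-half-nonPos (γ (other i)) (pair a b (basis i) γ)
    (subst (ℤ._≤ 0ℤ) (sym numerator≡) (numerator-nonPos {d} {m} {n} (rd-bound 2≤c 2≤d 5≤cd bound)))
  where
  open ≡-Reasoning
  c = offDiagonal b a (other i)
  d = offDiagonal b a i
  2≤c : 2 ≤ c
  2≤c = offDiagonal-≥2 2≤b 2≤a (other i)
  2≤d : 2 ≤ d
  2≤d = offDiagonal-≥2 2≤b 2≤a i
  5≤cd : 5 ≤ c * d
  5≤cd = offDiagonal-product 5≤ba i
  γi≡ : γ i ≡ + n
  γi≡ = trans (cong γ (sym (other-involutive i))) n≡
  numerator≡ : + 2 ℤ.* γ (other i) ℤ.+ + 3 ℤ.* pair a b (basis i) γ ≡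
               + 2 ℤ.* + m ℤ.+ + 3 ℤ.* (+ 2 ℤ.* + n ℤ.- + d ℤ.* + m)
  numerator≡ = begin
    + 2 ℤ.* γ (other i) ℤ.+ + 3 ℤ.* pair a b (basis i) γ
      ≡⟨ cong (λ p → + 2 ℤ.* γ (other i) ℤ.+ + 3 ℤ.* p)
              (trans (pair-transpose a b (basis i) γ) (pair-simpleCoroot b a i γ)) ⟩
    + 2 ℤ.* γ (other i) ℤ.+ + 3 ℤ.* (+ 2 ℤ.* γ i ℤ.- + d ℤ.* γ (other i))
      ≡⟨ cong₂ (λ x y → + 2 ℤ.* x ℤ.+ + 3 ℤ.* (+ 2 ℤ.* y ℤ.- + d ℤ.* x)) m≡ γi≡ ⟩
    + 2 ℤ.* + m ℤ.+ + 3 ℤ.* (+ 2 ℤ.* + n ℤ.- + d ℤ.* + m)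
      ∎

proposition5p2 : (a b : ℕ) → 2 ≤ a → 2 ≤ b → 5 ≤ a * b →
    (i : I) → PropertyRD a b i
proposition5p2 a b 2≤a 2≤b 5≤ab i = ⅓ , ℚP.positive⁻¹ ⅓ , rd
  where
  5≤ba : 5 ≤ b * a
  5≤ba = subst (5 ≤_) (*-comm a b) 5≤ab
  open RootCones a b 5≤ab
  rd : ∀ w → Nontrivial w → InWθ a b i w → ∀ u j → InΦ a b (inv w) (realRoot a b u j) →
       weightPair a b i ⅓ (realCoroot a b u j) ℚ.≤ ℚ.0ℚ
  rd (alt k n) _ w∈Wθ u j (α>0 , w⁻¹α<0) with k ≟ i | positiveRealRoot-cones 5≤ab u j α>0
  ... | yes refl | _ = contradiction w∈Wθ (alt∉Wθ k n)
  ... | no k≢i | l , α∈C , α∨∈C with l ≟ i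
  ...   | yes refl = contradiction w⁻¹α<0
          (cone⇒¬negative (inv-alt-cone k n (subst (λ l → Cone a b l _) (≢⇒≡other (≢-sym k≢i)) α∈C)))
  ...   | no l≢i = weightPair-nonPos 2≤a 2≤b 5≤ba i
          (subst (λ l → Cone b a l _) (≢⇒≡other l≢i) α∨∈C)
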